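{- Let $\mathcal C$ be a polarized GoI situation. For any objects $X,Y$ and any morphism $f:X\otimes U\to Y\otimes U$, $$\mathrm{Tr}^{U}_{X,Y}\big(f\circ(X\otimes 0_{U,U})\big)=\rho_1\circ f\circ\iota_1=\mathrm{Tr}^{U}_{X,Y}\big((Y\otimes 0_{U,U})\circ f\big),$$ where $\iota_1=X\otimes 0_{I,U}:X\cong X\otimes I\to X\otimes U$ and $\rho_1=Y\otimes 0_{U,I}:Y\otimes U\to Y\otimes I\cong Y$.
   Context: A polarized GoI situation consists of the following data and axioms. (1) A traced symmetric monoidal category $(\mathcal C,\otimes,I,s)$ with trace operators $\mathrm{Tr}^Z_{X,Y}:\mathcal C(X\otimes Z,Y\otimes Z)\to \mathcal C(X,Y)$ satisfying the usual axioms (naturality, dinaturality, vanishing, superposing, yanking); canonical associativity/unit isomorphisms are suppressed. (2) An object $U$ with $k:U\to U\otimes U$, $j:U\otimes U\to U$, $k\circ j=\mathrm{Id}_{U\otimes U}$. (3) An object $1$ with $!:1\otimes 1\to 1$, $r:1\to 1\otimes 1$, $!\circ r=\mathrm{Id}_1$. (4) A distinguished morphism $\alpha:1\to U$. (5) For every morphism $p:1\to U$ and all $f:X\otimes U\to Y\otimes U$, $g:X\otimes 1\to Y\otimes 1$ with $f\circ(X\otimes p)=(Y\otimes p)\circ g$: $\mathrm{Tr}^U_{X,Y}(f)=\mathrm{Tr}^1_{X,Y}(g)$. (6) $!_\alpha:U\otimes 1\to U$, $r_\alpha:U\to U\otimes 1$ with $!_\alpha\circ r_\alpha=\mathrm{Id}_U$,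 $!_\alpha\circ(\alpha\otimes 1)=\alpha\circ !$, $r_\alpha\circ\alpha=(\alpha\otimes 1)\circ r$. (7) $\alpha^*:U\to 1$ with $\alpha^*\circ\alpha=\mathrm{Id}_1$. (8) (Zero morphisms) A family $0_{X,Y}:X\to Y$ for all objects $X,Y$ with $g\circ 0_{X,Y}\circ f=0_{W,Z}$ for all $f:W\to X$, $g:Y\to Z$; $0:=0_{1,1}$. (9) For every $f:V\otimes U\to W\otimes U$, $(\mathrm{Id}_W\otimes !_\alpha)\circ(f\otimes 0)\circ(\mathrm{Id}_V\otimes r_\alpha)=f$; for every $f:V\otimes 1\to W\otimes 1$, $(\mathrm{Id}_W\otimes !)\circ(f\otimes 0)\circ(\mathrm{Id}_V\otimes r)=f$. -}

module Defs where

open import Level using (Level; _⊔_) renaming (suc to lsuc)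
open import Relation.Binary.PropositionalEquality using (_≡_)

record TracedSMC (o ℓ : Level) : Set (lsuc (o ⊔ ℓ)) where
  infixr 9 _∘_
  infixr 10 _⊗₀_ _⊗₁_
  field
    Obj : Set o
    Hom : Obj → Obj → Set ℓ
    id  : ∀ {A} → Hom A A
    _∘_ : ∀ {A B C} → Hom B C → Hom A B → Hom A C
    identityˡ : ∀ {A B} (f : Hom A B) → id ∘ f ≡ f
    identityʳ : ∀ {A B} (f : Hom A B) → f ∘ id ≡ f
    assoc : ∀ {A B C D} (f : Hom A B) (g : Hom B C) (h : Hom C D) →
            (h ∘ g) ∘ f ≡ h ∘ (g ∘ f)
    _⊗₀_ : Obj → Obj → Obj
    _⊗₁_ : ∀ {A B C D} → Hom A B → Hom C D → Hom (A ⊗₀ C) (B ⊗₀ D)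
    ⊗-id : ∀ {A B} → id {A} ⊗₁ id {B} ≡ id
    ⊗-∘  : ∀ {A B C D E F} (f : Hom A B) (g : Hom B C) (h : Hom D E) (k : Hom E F) →
           (g ∘ f) ⊗₁ (k ∘ h) ≡ (g ⊗₁ k) ∘ (f ⊗₁ h)
    I : Obj
    α⇒ : ∀ {A B C} → Hom ((A ⊗₀ B) ⊗₀ C) (A ⊗₀ (B ⊗₀ C))
    α⇐ : ∀ {A B C} → Hom (A ⊗₀ (B ⊗₀ C)) ((A ⊗₀ B) ⊗₀ C)
    α-isoˡ : ∀ {A B C} → α⇐ {A} {B} {C} ∘ α⇒ ≡ id
    α-isoʳ : ∀ {A B C} → α⇒ {A} {B} {C} ∘ α⇐ ≡ id
    α-natural : ∀ {A B C D E F} (f : Hom A B) (g : Hom C D) (h : Hom E F) →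
                α⇒ ∘ ((f ⊗₁ g) ⊗₁ h) ≡ (f ⊗₁ (g ⊗₁ h)) ∘ α⇒
    λ⇒ : ∀ {A} → Hom (I ⊗₀ A) A
    λ⇐ : ∀ {A} → Hom A (I ⊗₀ A)
    λ-isoˡ : ∀ {A} → λ⇐ {A} ∘ λ⇒ ≡ id
    λ-isoʳ : ∀ {A} → λ⇒ {A} ∘ λ⇐ ≡ id
    λ-natural : ∀ {A B} (f : Hom A B) → λ⇒ ∘ (id ⊗₁ f) ≡ f ∘ λ⇒
    ρ⇒ : ∀ {A} → Hom (A ⊗₀ I) A
    ρ⇐ : ∀ {A} → Hom A (A ⊗₀ I)
    ρ-isoˡ : ∀ {A} → ρ⇐ {A} ∘ ρ⇒ ≡ id
    ρ-isoʳ : ∀ {A} → ρ⇒ {A} ∘ ρ⇐ ≡ id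
    ρ-natural : ∀ {A B} (f : Hom A B) → ρ⇒ ∘ (f ⊗₁ id) ≡ f ∘ ρ⇒
    triangle : ∀ {A B} → (id {A} ⊗₁ λ⇒ {B}) ∘ α⇒ ≡ ρ⇒ ⊗₁ id
    pentagon : ∀ {A B C D} →
               (id {A} ⊗₁ α⇒ {B} {C} {D}) ∘ (α⇒ ∘ (α⇒ ⊗₁ id)) ≡ α⇒ ∘ α⇒
    σ : ∀ {A B} → Hom (A ⊗₀ B) (B ⊗₀ A)
    σ-natural : ∀ {A B C D} (f : Hom A B) (g : Hom C D) →
                σ ∘ (f ⊗₁ g) ≡ (g ⊗₁ f) ∘ σ
    σ-involutive : ∀ {A B} → σ {B} {A} ∘ σ {A} {B} ≡ id
    hexagon : ∀ {A B C} →
              α⇒ {B} {C} {A} ∘ (σ {A} {B ⊗₀ C} ∘ α⇒) ≡ (id ⊗₁ σ) ∘ (α⇒ ∘ (σ ⊗₁ id))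
    Tr : ∀ {X Y} Z → Hom (X ⊗₀ Z) (Y ⊗₀ Z) → Hom X Y
    Tr-naturality : ∀ {X X′ Y Y′ Z} (f : Hom (X ⊗₀ Z) (Y ⊗₀ Z)) (g : Hom X′ X) (h : Hom Y Y′) →
                    Tr Z ((h ⊗₁ id) ∘ (f ∘ (g ⊗₁ id))) ≡ h ∘ (Tr Z f ∘ g)
    Tr-dinaturality : ∀ {X Y Z Z′} (f : Hom (X ⊗₀ Z) (Y ⊗₀ Z′)) (g : Hom Z′ Z) →
                      Tr Z ((id ⊗₁ g) ∘ f) ≡ Tr Z′ (f ∘ (id ⊗₁ g))
    Tr-vanishing-I : ∀ {X Y} (f : Hom (X ⊗₀ I) (Y ⊗₀ I)) →
                     Tr I f ≡ ρ⇒ ∘ (f ∘ ρ⇐)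
    Tr-vanishing-⊗ : ∀ {X Y Z W} (f : Hom (X ⊗₀ (Z ⊗₀ W)) (Y ⊗₀ (Z ⊗₀ W))) →
                     Tr (Z ⊗₀ W) f ≡ Tr Z (Tr W (α⇐ ∘ (f ∘ α⇒)))
    Tr-superposing : ∀ {W V X Y Z} (g : Hom W V) (f : Hom (X ⊗₀ Z) (Y ⊗₀ Z)) →
                     Tr Z (α⇐ ∘ ((g ⊗₁ f) ∘ α⇒)) ≡ g ⊗₁ Tr Z f
    Tr-yanking : ∀ {X} → Tr X (σ {X} {X}) ≡ id

record PolarizedGoI (o ℓ : Level) : Set (lsuc (o ⊔ ℓ)) where
  field
    C : TracedSMC o ℓ
  open TracedSMC C
  field
    U : Obj
    k : Hom U (U ⊗₀ U)
    j : Hom (U ⊗₀ U) U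
    k∘j : k ∘ j ≡ id
    𝟙 : Obj
    ! : Hom (𝟙 ⊗₀ 𝟙) 𝟙
    r : Hom 𝟙 (𝟙 ⊗₀ 𝟙)
    !∘r : ! ∘ r ≡ id
    a : Hom 𝟙 U
    trace-transfer : ∀ (p : Hom 𝟙 U) {X Y} (f : Hom (X ⊗₀ U) (Y ⊗₀ U)) (g : Hom (X ⊗₀ 𝟙) (Y ⊗₀ 𝟙)) →
                     f ∘ (id ⊗₁ p) ≡ (id ⊗₁ p) ∘ g → Tr U f ≡ Tr 𝟙 g
    !a : Hom (U ⊗₀ 𝟙) U
    ra : Hom U (U ⊗₀ 𝟙)
    !a∘ra : !a ∘ ra ≡ id
    !a-a : !a ∘ (a ⊗₁ id) ≡ a ∘ !
    ra-a : ra ∘ a ≡ (a ⊗₁ id) ∘ r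
    a* : Hom U 𝟙
    a*∘a : a* ∘ a ≡ id
    0h : ∀ X Y → Hom X Y
    zero-absorb : ∀ {W X Y Z} (f : Hom W X) (g : Hom Y Z) → g ∘ (0h X Y ∘ f) ≡ 0h W Z
    retract-U : ∀ {V W} (f : Hom (V ⊗₀ U) (W ⊗₀ U)) →
                (id ⊗₁ !a) ∘ (α⇒ ∘ ((f ⊗₁ 0h 𝟙 𝟙) ∘ (α⇐ ∘ (id ⊗₁ ra)))) ≡ f
    retract-𝟙 : ∀ {V W} (f : Hom (V ⊗₀ 𝟙) (W ⊗₀ 𝟙)) →
                (id ⊗₁ !) ∘ (α⇒ ∘ ((f ⊗₁ 0h 𝟙 𝟙) ∘ (α⇐ ∘ (id ⊗₁ r)))) ≡ f
  open TracedSMC C public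

-- Since 0_{U,U} = 0_{I,U} ∘ 0_{U,I} factors through I, dinaturality moves the
-- factor 0_{U,I} around the loop, turning the trace over U into a trace over I,
-- which vanishes.
module Submission where

open import Defs
open import Data.Product using (_×_; _,_)
open import Relation.Binary.PropositionalEquality using (_≡_; sym; cong; module ≡-Reasoning)

module TracedProperties {o ℓ} (C : TracedSMC o ℓ) where
  open TracedSMC C
  open ≡-Reasoning

  id⊗-∘ : ∀ {A B D E} (g : Hom D E) (h : Hom B D) →
          id {A} ⊗₁ (g ∘ h) ≡ (id ⊗₁ g) ∘ (id ⊗₁ h)
  id⊗-∘ g h = begin
    id ⊗₁ (g ∘ h)          ≡⟨ cong (_⊗₁ (g ∘ h)) (sym (identityˡ id)) ⟩
    (id ∘ id) ⊗₁ (g ∘ h)   ≡⟨ ⊗-∘ _ _ _ _ ⟩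
    (id ⊗₁ g) ∘ (id ⊗₁ h)  ∎

  module _ {X Y Z} (f : Hom (X ⊗₀ Z) (Y ⊗₀ Z)) (g : Hom I Z) (h : Hom Z I) where

    Tr-I-sandwich : Tr I ((id ⊗₁ h) ∘ (f ∘ (id ⊗₁ g))) ≡
                    (ρ⇒ ∘ (id ⊗₁ h)) ∘ (f ∘ ((id ⊗₁ g) ∘ ρ⇐))
    Tr-I-sandwich = begin
      Tr I ((id ⊗₁ h) ∘ (f ∘ (id ⊗₁ g)))        ≡⟨ Tr-vanishing-I _ ⟩
      ρ⇒ ∘ (((id ⊗₁ h) ∘ (f ∘ (id ⊗₁ g))) ∘ ρ⇐) ≡⟨ cong (ρ⇒ ∘_) (assoc _ _ _) ⟩
      ρ⇒ ∘ ((id ⊗₁ h) ∘ ((f ∘ (id ⊗₁ g)) ∘ ρ⇐)) ≡⟨ sym (assoc _ _ _) ⟩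
      (ρ⇒ ∘ (id ⊗₁ h)) ∘ ((f ∘ (id ⊗₁ g)) ∘ ρ⇐) ≡⟨ cong ((ρ⇒ ∘ (id ⊗₁ h)) ∘_) (assoc _ _ _) ⟩
      (ρ⇒ ∘ (id ⊗₁ h)) ∘ (f ∘ ((id ⊗₁ g) ∘ ρ⇐)) ∎

    Tr-∘-factor-through-I : Tr Z (f ∘ (id ⊗₁ (g ∘ h))) ≡
                            (ρ⇒ ∘ (id ⊗₁ h)) ∘ (f ∘ ((id ⊗₁ g) ∘ ρ⇐))
    Tr-∘-factor-through-I = begin
      Tr Z (f ∘ (id ⊗₁ (g ∘ h)))               ≡⟨ cong (λ e → Tr Z (f ∘ e)) (id⊗-∘ g h) ⟩
      Tr Z (f ∘ ((id ⊗₁ g) ∘ (id ⊗₁ h)))       ≡⟨ cong (Tr Z) (sym (assoc _ _ _)) ⟩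
      Tr Z ((f ∘ (id ⊗₁ g)) ∘ (id ⊗₁ h))       ≡⟨ sym (Tr-dinaturality _ _) ⟩
      Tr I ((id ⊗₁ h) ∘ (f ∘ (id ⊗₁ g)))       ≡⟨ Tr-I-sandwich ⟩
      (ρ⇒ ∘ (id ⊗₁ h)) ∘ (f ∘ ((id ⊗₁ g) ∘ ρ⇐)) ∎

    Tr-factor-through-I-∘ : Tr Z ((id ⊗₁ (g ∘ h)) ∘ f) ≡
                            (ρ⇒ ∘ (id ⊗₁ h)) ∘ (f ∘ ((id ⊗₁ g) ∘ ρ⇐))
    Tr-factor-through-I-∘ = begin
      Tr Z ((id ⊗₁ (g ∘ h)) ∘ f)               ≡⟨ cong (λ e → Tr Z (e ∘ f)) (id⊗-∘ g h) ⟩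
      Tr Z (((id ⊗₁ g) ∘ (id ⊗₁ h)) ∘ f)       ≡⟨ cong (Tr Z) (assoc _ _ _) ⟩
      Tr Z ((id ⊗₁ g) ∘ ((id ⊗₁ h) ∘ f))       ≡⟨ Tr-dinaturality _ _ ⟩
      Tr I (((id ⊗₁ h) ∘ f) ∘ (id ⊗₁ g))       ≡⟨ cong (Tr I) (assoc _ _ _) ⟩
      Tr I ((id ⊗₁ h) ∘ (f ∘ (id ⊗₁ g)))       ≡⟨ Tr-I-sandwich ⟩
      (ρ⇒ ∘ (id ⊗₁ h)) ∘ (f ∘ ((id ⊗₁ g) ∘ ρ⇐)) ∎

module ZeroProperties {o ℓ} (G : PolarizedGoI o ℓ) where
  open PolarizedGoI G

  0h-∘-0h : ∀ A B D → 0h B D ∘ 0h A B ≡ 0h A D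
  0h-∘-0h A B D = begin
    0h B D ∘ 0h A B         ≡⟨ cong (0h B D ∘_) (sym (identityʳ _)) ⟩
    0h B D ∘ (0h A B ∘ id)  ≡⟨ zero-absorb id (0h B D) ⟩
    0h A D                  ∎
    where open ≡-Reasoning

mainTheorem6 : ∀ {o ℓ} (G : PolarizedGoI o ℓ) →
    let open PolarizedGoI G in
    ∀ {X Y} (f : Hom (X ⊗₀ U) (Y ⊗₀ U)) →
      (Tr U (f ∘ (id ⊗₁ 0h U U)) ≡ (ρ⇒ ∘ (id ⊗₁ 0h U I)) ∘ (f ∘ ((id ⊗₁ 0h I U) ∘ ρ⇐)))
      × ((ρ⇒ ∘ (id ⊗₁ 0h U I)) ∘ (f ∘ ((id ⊗₁ 0h I U) ∘ ρ⇐)) ≡ Tr U ((id ⊗₁ 0h U U) ∘ f))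
mainTheorem6 G f =
  (begin
    Tr U (f ∘ (id ⊗₁ 0h U U))            ≡⟨ cong (λ z → Tr U (f ∘ (id ⊗₁ z))) 0UU-via-I ⟩
    Tr U (f ∘ (id ⊗₁ (0h I U ∘ 0h U I))) ≡⟨ Tr-∘-factor-through-I f (0h I U) (0h U I) ⟩
    _                                    ∎)
  , (begin
    _                                    ≡⟨ Tr-factor-through-I-∘ f (0h I U) (0h U I) ⟨
    Tr U ((id ⊗₁ (0h I U ∘ 0h U I)) ∘ f) ≡⟨ cong (λ z → Tr U ((id ⊗₁ z) ∘ f)) 0UU-via-I ⟨
    Tr U ((id ⊗₁ 0h U U) ∘ f)            ∎)
  where
  open PolarizedGoI G
  open TracedProperties C
  open ZeroProperties G
  open ≡-Reasoning

  0UU-via-I : 0h U U ≡ 0h I U ∘ 0h U I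
  0UU-via-I = sym (0h-∘-0h U I U)
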